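{- For every graph $G$ and every integer $s\ge0$, $$\mu(K_s\ast G)=\max\{1,\mu(G)-s\},\qquad \check{\mu}(K_s\ast G)=\max\{0,\check{\mu}(G)-s\}.$$ In particular, if $K_s\ast G$ is Hamiltonian then $\mu(K_s\ast G)=1$ and $\check{\mu}(K_s\ast G)=0$; otherwise $\mu(K_s\ast G)=\mu(G)-s$ and $\check{\mu}(K_s\ast G)=\check{\mu}(G)-s$.
   Context: All graphs are finite and simple with nonempty vertex set. By convention $K_1$ and $K_2$ are regarded as Hamiltonian (in addition to graphs with a Hamiltonian cycle). $G\ast H$ is the join ($G\sqcup H$ plus all edges between $V(G)$ and $V(H)$); $K_0$ is the empty graph so $K_0\ast G=G$. A path may consist of a single vertex. An $s$-path covering of $G$ is a set of $s$ vertex-disjoint paths in $G$ containing every vertex of $G$. $\mu(G)$ is the minimum $s\in\mathbb{N}$ such that $G$ has an $s$-path covering; $\check{\mu}(G)=\min\{l\in\mathbb{N}_0: K_l\ast G\text{ is Hamiltonian}\}$. -}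

module Defs where

open import Data.Nat using (ℕ; zero; suc; _+_; _≤_)
open import Data.Fin using (Fin; splitAt)
open import Data.List using (List; []; _∷_; _++_; [_]; concat; length)
open import Data.List.Relation.Unary.All using (All)
open import Data.List.Relation.Unary.Linked using (Linked)
open import Data.List.Relation.Unary.Unique.Propositional using (Unique)
open import Data.List.Membership.Propositional using (_∈_)
open import Data.Sum using (_⊎_; inj₁; inj₂)
open import Data.Product using (Σ; ∃; ∃-syntax; _×_; _,_)
open import Data.Unit using (⊤)
open import Relation.Nullary using (¬_)
open import Relation.Binary.PropositionalEquality using (_≡_; _≢_; refl; sym)

record Graph : Set₁ where
  field
    k      : ℕ
    Adj    : Fin (suc k) → Fin (suc k) → Set
    adj-sym   : ∀ {x y} → Adj x y → Adj y x
    adj-irrefl : ∀ x → ¬ Adj x x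

open Graph public

order : Graph → ℕ
order G = suc (k G)

Vertex : Graph → Set
Vertex G = Fin (order G)

-- Join K_l ∗ G : vertices Fin (|G| + l); the first |G| vertices are a copy
-- of G, the last l vertices form a clique and are adjacent to every vertex
-- of G.  (Vertex order is immaterial; G first makes |K_l ∗ G| = suc (k + l)
-- definitionally.)  K_0 ∗ G has the same vertices and adjacency as G.
module _ (l : ℕ) (G : Graph) where
  JAdj' : (Vertex G ⊎ Fin l) → (Vertex G ⊎ Fin l) → Set
  JAdj' (inj₁ x) (inj₁ y) = Adj G x y
  JAdj' (inj₁ x) (inj₂ b) = ⊤
  JAdj' (inj₂ a) (inj₁ y) = ⊤
  JAdj' (inj₂ a) (inj₂ b) = a ≢ b

  JAdj'-sym : ∀ u v → JAdj' u v → JAdj' v u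
  JAdj'-sym (inj₁ x) (inj₁ y) e = adj-sym G e
  JAdj'-sym (inj₁ x) (inj₂ b) _ = _
  JAdj'-sym (inj₂ a) (inj₁ y) _ = _
  JAdj'-sym (inj₂ a) (inj₂ b) ne eq = ne (sym eq)

  JAdj'-irrefl : ∀ u → ¬ JAdj' u u
  JAdj'-irrefl (inj₁ x) e = adj-irrefl G x e
  JAdj'-irrefl (inj₂ a) ne = ne refl

join : ℕ → Graph → Graph
join l G = record
  { k = k G + l
  ; Adj = λ x y → JAdj' l G (splitAt (order G) x) (splitAt (order G) y)
  ; adj-sym = λ {x} {y} → JAdj'-sym l G (splitAt (order G) x) (splitAt (order G) y)
  ; adj-irrefl = λ x → JAdj'-irrefl l G (splitAt (order G) x)
  }

IsPath : (G : Graph) → List (Vertex G) → Set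
IsPath G xs = (xs ≢ []) × Unique xs × Linked (Adj G) xs

PathCovering : (G : Graph) → ℕ → Set
PathCovering G s =
  Σ (List (List (Vertex G))) λ ps →
    (length ps ≡ s) × All (IsPath G) ps × Unique (concat ps)
    × (∀ v → v ∈ concat ps)

HasHamiltonianCycle : Graph → Set
HasHamiltonianCycle G =
  Σ (Vertex G) λ x → Σ (List (Vertex G)) λ ys →
    (2 ≤ length ys) × Unique (x ∷ ys) × (∀ v → v ∈ x ∷ ys)
    × Linked (Adj G) (x ∷ ys ++ [ x ])

IsK1 : Graph → Set
IsK1 G = order G ≡ 1

IsK2 : Graph → Set
IsK2 G = (order G ≡ 2) × ∃[ x ] ∃[ y ] Adj G x y

Hamiltonian : Graph → Set
Hamiltonian G = IsK1 G ⊎ IsK2 G ⊎ HasHamiltonianCycle G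

IsMu : Graph → ℕ → Set
IsMu G m = PathCovering G m × (∀ s → PathCovering G s → m ≤ s)

IsMuCheck : Graph → ℕ → Set
IsMuCheck G m = Hamiltonian (join m G) × (∀ l → Hamiltonian (join l G) → m ≤ l)

-- Adding one universal vertex a to a graph H: a k-path covering of H becomes a
-- max(1, k − 1)-path covering of K₁ ∗ H by threading a between two of its paths,
-- and deleting a from a path covering of K₁ ∗ H splits at most one path in two,
-- so μ(K₁ ∗ H) = max(1, μ(H) − 1). Since K_l ∗ (K_s ∗ G) ≅ K_{l+s} ∗ G,
-- iterating gives μ(K_s ∗ G) = max(1, μ(G) − s).
-- A spanning path of H closes through a to a Hamiltonian cycle of K₁ ∗ H (or
-- K₁ ∗ H is K₂). Hence Hamiltonicity of K_l ∗ G is monotone in l, which with the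
-- same isomorphism gives μ̌(K_s ∗ G) = μ̌(G) − s; and if K_s ∗ G is not
-- Hamiltonian then s < μ(G), for otherwise K_{s−1} ∗ G has a spanning path.
module Submission where

open import Data.Empty using (⊥-elim)
open import Function using (_∘_)
open import Data.Fin using (Fin; zero; suc; splitAt; _↑ˡ_; _↑ʳ_) renaming (join to joinFin)
open import Data.Fin.Properties using (splitAt-join; join-splitAt; splitAt-↑ˡ; splitAt-↑ʳ; ↑ˡ-injective; ↑ʳ-injective; cantor-schröder-bernstein)
open import Data.List using (List; []; _∷_; _++_; [_]; concat; length; map)
open import Data.List.NonEmpty as List⁺ using (List⁺; _∷_; _∷⁺_; toList)
open import Data.List.Properties using (++-assoc; ++-identityʳ; length-++; length-++-sucʳ; length-map; map-++; concat-map; concat-++)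
open import Data.List.Membership.Propositional using (_∈_; _∉_)
open import Data.List.Membership.Propositional.Properties using (∈-map⁺; ∈-map⁻; ∈-++⁺ˡ)
open import Data.List.Relation.Unary.All as All using (All; []; _∷_)
import Data.List.Relation.Unary.All.Properties as Allₚ
open import Data.List.Relation.Unary.Any using (here; there)
open import Data.List.Relation.Unary.Linked as Linked using (Linked; []; [-]; _∷_)
import Data.List.Relation.Unary.Linked.Properties as Linkedₚ
open import Data.List.Relation.Unary.Unique.Propositional using (Unique; []; _∷_)
import Data.List.Relation.Unary.Unique.Propositional.Properties as Uniqueₚ
open import Data.List.Relation.Binary.Permutation.Propositional using (_↭_; ↭-sym; ↭⇒↭ₛ; module PermutationReasoning)
open import Data.List.Relation.Binary.Permutation.Propositional.Properties using (∈-resp-↭; ++-comm; shift)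
import Data.List.Relation.Binary.Permutation.Setoid.Properties as Permutationₛ
open import Data.Nat using (ℕ; zero; suc; pred; _+_; _≤_; _<_; _≤′_; ≤′-refl; ≤′-step; _⊔_; _∸_; z≤n; s≤s; _≤?_)
open import Data.Nat.Properties
open import Algebra.Properties.CommutativeSemigroup +-commutativeSemigroup using (x∙yz≈y∙xz)
open import Data.Product using (Σ; ∃-syntax; _×_; _,_; proj₁; proj₂)
open import Data.Sum using (_⊎_; inj₁; inj₂)
open import Data.Sum.Properties using (inj₁-injective)
open import Data.Unit using (tt)
open import Relation.Binary.Definitions using (_Respects_)
open import Relation.Binary.PropositionalEquality using (_≡_; _≢_; refl; sym; trans; cong; cong₂; subst; subst₂; setoid; module ≡-Reasoning)
open import Relation.Nullary using (¬_; yes; no; contradiction)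

open import Defs

private variable
  A V : Set

Unique-++⁻ : (xs : List A) {ys : List A} → Unique (xs ++ ys) → Unique xs × Unique ys
Unique-++⁻ []       u        = [] , u
Unique-++⁻ (x ∷ xs) (x∉ ∷ u) = let uxs , uys = Unique-++⁻ xs u in Allₚ.++⁻ˡ xs x∉ ∷ uxs , uys

Unique-concat⁻ : (xss : List (List A)) → Unique (concat xss) → All Unique xss
Unique-concat⁻ []         _ = []
Unique-concat⁻ (xs ∷ xss) u = let uxs , uxss = Unique-++⁻ xs u in uxs ∷ Unique-concat⁻ xss uxss

Unique-resp-↭ : Unique {A = A} Respects _↭_
Unique-resp-↭ p = Permutationₛ.Unique-resp-↭ (setoid _) (↭⇒↭ₛ p)

Linked-++⁻ˡ : ∀ {R : A → A → Set} (xs : List A) {ys : List A} → Linked R (xs ++ ys) → Linked R xs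
Linked-++⁻ˡ []           _       = []
Linked-++⁻ˡ (x ∷ [])     _       = [-]
Linked-++⁻ˡ (x ∷ y ∷ xs) (r ∷ l) = r ∷ Linked-++⁻ˡ (y ∷ xs) l

module _ {V : Set} (R : V → V → Set) where

  Path : List V → Set
  Path xs = (xs ≢ []) × Unique xs × Linked R xs

  PathCover : ℕ → Set
  PathCover t = Σ (List (List V)) λ ps →
    (length ps ≡ t) × All Path ps × Unique (concat ps) × (∀ v → v ∈ concat ps)

  SpanningPath : Set
  SpanningPath = Σ (List V) λ p → Path p × (∀ v → v ∈ p)

  HamCycle : Set
  HamCycle = Σ V λ x → Σ (List V) λ ys →
    (2 ≤ length ys) × Unique (x ∷ ys) × (∀ v → v ∈ x ∷ ys) × Linked R (x ∷ ys ++ [ x ])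

module _ {R : V → V → Set} where

  pathCover : (qs : List (List V)) → All (λ q → (q ≢ []) × Linked R q) qs →
              Unique (concat qs) → (∀ v → v ∈ concat qs) → PathCover R (length qs)
  pathCover qs nonEmpty-linked u c =
    qs , refl , All.zipWith (λ ((ne , l) , uq) → ne , uq , l) (nonEmpty-linked , Unique-concat⁻ qs u) , u , c

  SpanningPath⇒PathCover₁ : SpanningPath R → PathCover R 1
  SpanningPath⇒PathCover₁ (p , path , c) =
    [ p ] , refl , path ∷ [] , subst Unique (sym (++-identityʳ p)) (proj₁ (proj₂ path)) , λ v → ∈-++⁺ˡ (c v)

  PathCover₁⇒SpanningPath : PathCover R 1 → SpanningPath R
  PathCover₁⇒SpanningPath ((p ∷ []) , refl , path ∷ [] , _ , c) =
    p , path , λ v → subst (v ∈_) (++-identityʳ p) (c v)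

record _≅_ {V₁ V₂ : Set} (R₁ : V₁ → V₁ → Set) (R₂ : V₂ → V₂ → Set) : Set where
  field
    to       : V₁ → V₂
    from     : V₂ → V₁
    from∘to  : ∀ x → from (to x) ≡ x
    to∘from  : ∀ y → to (from y) ≡ y
    to-hom   : ∀ {x y} → R₁ x y → R₂ (to x) (to y)
    from-hom : ∀ {x y} → R₂ x y → R₁ (from x) (from y)

  to-injective : ∀ {x y} → to x ≡ to y → x ≡ y
  to-injective {x} {y} eq = trans (sym (from∘to x)) (trans (cong from eq) (from∘to y))

  from-injective : ∀ {x y} → from x ≡ from y → x ≡ y
  from-injective {x} {y} eq = trans (sym (to∘from x)) (trans (cong to eq) (to∘from y))

open _≅_

module _ {V₁ V₂ : Set} {R₁ : V₁ → V₁ → Set} {R₂ : V₂ → V₂ → Set} where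

  ≅-sym : R₁ ≅ R₂ → R₂ ≅ R₁
  ≅-sym i = record
    { to = from i ; from = to i ; from∘to = to∘from i ; to∘from = from∘to i
    ; to-hom = from-hom i ; from-hom = to-hom i }

module _ {V₁ V₂ V₃ : Set} {R₁ : V₁ → V₁ → Set} {R₂ : V₂ → V₂ → Set} {R₃ : V₃ → V₃ → Set} where

  ≅-trans : R₁ ≅ R₂ → R₂ ≅ R₃ → R₁ ≅ R₃
  ≅-trans i j = record
    { to       = λ x → to j (to i x)
    ; from     = λ z → from i (from j z)
    ; from∘to  = λ x → trans (cong (from i) (from∘to j (to i x))) (from∘to i x)
    ; to∘from  = λ z → trans (cong (to j) (to∘from i (from j z))) (to∘from j z)
    ; to-hom   = λ r → to-hom j (to-hom i r)
    ; from-hom = λ r → from-hom i (from-hom j r) }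

module _ {V₁ V₂ : Set} {R₁ : V₁ → V₁ → Set} {R₂ : V₂ → V₂ → Set} (i : R₁ ≅ R₂) where

  private
    ∈-map-to : ∀ {xs} y → from i y ∈ xs → y ∈ map (to i) xs
    ∈-map-to y m = subst (_∈ _) (to∘from i y) (∈-map⁺ (to i) m)

    Linked-map-to : ∀ {xs} → Linked R₁ xs → Linked R₂ (map (to i) xs)
    Linked-map-to l = Linkedₚ.map⁺ (Linked.map (to-hom i) l)

  Path-map : ∀ {xs} → Path R₁ xs → Path R₂ (map (to i) xs)
  Path-map {[]}    (ne , _) = ⊥-elim (ne refl)
  Path-map {_ ∷ _} (_ , u , l) = (λ ()) , Uniqueₚ.map⁺ (to-injective i) u , Linked-map-to l

  PathCover-map : ∀ {t} → PathCover R₁ t → PathCover R₂ t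
  PathCover-map (ps , refl , paths , u , c) =
      map (map (to i)) ps , length-map _ ps , Allₚ.map⁺ (All.map Path-map paths)
    , subst Unique (sym (concat-map ps)) (Uniqueₚ.map⁺ (to-injective i) u)
    , λ v → subst (v ∈_) (sym (concat-map ps)) (∈-map-to v (c (from i v)))

  HamCycle-map : HamCycle R₁ → HamCycle R₂
  HamCycle-map (x , ys , 2≤ , u , c , l) =
      to i x , map (to i) ys , subst (2 ≤_) (sym (length-map _ ys)) 2≤
    , Uniqueₚ.map⁺ (to-injective i) u , (λ v → ∈-map-to v (c (from i v)))
    , subst (Linked R₂) (cong (to i x ∷_) (map-++ (to i) ys [ x ])) (Linked-map-to l)

private variable
  G H : Graph
  c l l′ m s t : ℕ

order-≅ : Adj G ≅ Adj H → order G ≡ order H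
order-≅ i = cantor-schröder-bernstein (to-injective i) (from-injective i)

Hamiltonian-≅ : Adj G ≅ Adj H → Hamiltonian G → Hamiltonian H
Hamiltonian-≅ {G} {H} i (inj₁ k1) = inj₁ (trans (sym (order-≅ {G} {H} i)) k1)
Hamiltonian-≅ {G} {H} i (inj₂ (inj₁ (k2 , x , y , e))) =
  inj₂ (inj₁ (trans (sym (order-≅ {G} {H} i)) k2 , to i x , to i y , to-hom i e))
Hamiltonian-≅ i (inj₂ (inj₂ c)) = inj₂ (inj₂ (HamCycle-map i c))

IsMu-≅ : Adj G ≅ Adj H → IsMu G m → IsMu H m
IsMu-≅ i (cover , minimal) = PathCover-map i cover , λ t c → minimal t (PathCover-map (≅-sym i) c)

PathCovering-positive : PathCovering G t → 0 < t
PathCovering-positive ([] , refl , _ , _ , c) with c zero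
... | ()
PathCovering-positive ((_ ∷ _) , refl , _) = s≤s z≤n

IsMu-positive : IsMu G m → 0 < m
IsMu-positive {G} = PathCovering-positive {G} ∘ proj₁

order≡1 : ∀ {n} → suc n ≡ 1 → (x v : Fin (suc n)) → v ≡ x
order≡1 refl zero zero = refl

order≡2 : ∀ {n} → suc n ≡ 2 → (x y : Fin (suc n)) → x ≢ y → ∀ v → v ∈ x ∷ y ∷ []
order≡2 refl zero       zero       x≢y _          = ⊥-elim (x≢y refl)
order≡2 refl zero       (suc zero) _   zero       = here refl
order≡2 refl zero       (suc zero) _   (suc zero) = there (here refl)
order≡2 refl (suc zero) zero       _   zero       = there (here refl)
order≡2 refl (suc zero) zero       _   (suc zero) = here refl
order≡2 refl (suc zero) (suc zero) x≢y _          = ⊥-elim (x≢y refl)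

singleton-spanning⇒order≡1 : ∀ {n} (x : Fin (suc n)) → (∀ v → v ∈ [ x ]) → suc n ≡ 1
singleton-spanning⇒order≡1 {zero}  _ _ = refl
singleton-spanning⇒order≡1 {suc n} x c with c zero | c (suc zero)
... | here refl | here ()

Hamiltonian⇒SpanningPath : Hamiltonian G → SpanningPath (Adj G)
Hamiltonian⇒SpanningPath {G} (inj₁ k1) =
  [ zero ] , ((λ ()) , [] ∷ [] , [-]) , λ v → here (order≡1 k1 zero v)
Hamiltonian⇒SpanningPath {G} (inj₂ (inj₁ (k2 , x , y , e))) =
  x ∷ y ∷ [] , ((λ ()) , (x≢y ∷ []) ∷ [] ∷ [] , e ∷ [-]) , order≡2 k2 x y x≢y
  where x≢y : x ≢ y
        x≢y refl = adj-irrefl G x e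
Hamiltonian⇒SpanningPath {G} (inj₂ (inj₂ (x , ys , _ , u , c , l))) =
  x ∷ ys , ((λ ()) , u , Linked-++⁻ˡ (x ∷ ys) l) , c

IsMu-Hamiltonian : IsMu G m → Hamiltonian G → m ≡ 1
IsMu-Hamiltonian {G} μ h =
  ≤-antisym (proj₂ μ 1 (SpanningPath⇒PathCover₁ (Hamiltonian⇒SpanningPath {G} h))) (IsMu-positive {G} μ)

module _ {V B : Set} where

  lefts : List (V ⊎ B) → List V
  lefts []           = []
  lefts (inj₁ x ∷ w) = x ∷ lefts w
  lefts (inj₂ _ ∷ w) = lefts w

  #rights : List (V ⊎ B) → ℕ
  #rights []           = 0
  #rights (inj₁ _ ∷ w) = #rights w
  #rights (inj₂ _ ∷ w) = suc (#rights w)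

  runs : List (V ⊎ B) → List⁺ (List V)
  runs []           = [] ∷ []
  runs (inj₁ x ∷ w) = let r ∷ rs = runs w in (x ∷ r) ∷ rs
  runs (inj₂ _ ∷ w) = [] ∷⁺ runs w

  dropEmpty : List (List V) → List (List V)
  dropEmpty []             = []
  dropEmpty ([] ∷ xss)     = dropEmpty xss
  dropEmpty ((x ∷ xs) ∷ xss) = (x ∷ xs) ∷ dropEmpty xss

  pieces : List (V ⊎ B) → List (List V)
  pieces w = dropEmpty (toList (runs w))

  deleteRights : List (List (V ⊎ B)) → List (List V)
  deleteRights ws = concat (map pieces ws)

  lefts-++ : ∀ xs ys → lefts (xs ++ ys) ≡ lefts xs ++ lefts ys
  lefts-++ []           ys = refl
  lefts-++ (inj₁ x ∷ xs) ys = cong (x ∷_) (lefts-++ xs ys)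
  lefts-++ (inj₂ _ ∷ xs) ys = lefts-++ xs ys

  #rights-++ : ∀ xs ys → #rights (xs ++ ys) ≡ #rights xs + #rights ys
  #rights-++ []            ys = refl
  #rights-++ (inj₁ _ ∷ xs) ys = #rights-++ xs ys
  #rights-++ (inj₂ _ ∷ xs) ys = cong suc (#rights-++ xs ys)

  ∈-lefts : ∀ {x} w → inj₁ x ∈ w → x ∈ lefts w
  ∈-lefts (inj₁ _ ∷ w) (here refl) = here refl
  ∈-lefts (inj₁ _ ∷ w) (there m)   = there (∈-lefts w m)
  ∈-lefts (inj₂ _ ∷ w) (there m)   = ∈-lefts w m

  lefts-∈ : ∀ {x} w → x ∈ lefts w → inj₁ x ∈ w
  lefts-∈ (inj₁ _ ∷ w) (here refl) = here refl
  lefts-∈ (inj₁ _ ∷ w) (there m)   = there (lefts-∈ w m)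
  lefts-∈ (inj₂ _ ∷ w) m           = there (lefts-∈ w m)

  Unique-lefts : ∀ w → Unique w → Unique (lefts w)
  Unique-lefts []           _        = []
  Unique-lefts (inj₁ x ∷ w) (x∉ ∷ u) =
    Allₚ.¬Any⇒All¬ _ (λ m → Allₚ.All¬⇒¬Any x∉ (lefts-∈ w m)) ∷ Unique-lefts w u
  Unique-lefts (inj₂ _ ∷ w) (_ ∷ u)  = Unique-lefts w u

  concat-dropEmpty : ∀ xss → concat (dropEmpty xss) ≡ concat xss
  concat-dropEmpty []               = refl
  concat-dropEmpty ([] ∷ xss)       = concat-dropEmpty xss
  concat-dropEmpty ((x ∷ xs) ∷ xss) = cong ((x ∷ xs) ++_) (concat-dropEmpty xss)

  length-dropEmpty : ∀ xss → length (dropEmpty xss) ≤ length xss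
  length-dropEmpty []               = z≤n
  length-dropEmpty ([] ∷ xss)       = m≤n⇒m≤1+n (length-dropEmpty xss)
  length-dropEmpty ((x ∷ xs) ∷ xss) = s≤s (length-dropEmpty xss)

  dropEmpty-nonEmpty : ∀ xss → All (_≢ []) (dropEmpty xss)
  dropEmpty-nonEmpty []               = []
  dropEmpty-nonEmpty ([] ∷ xss)       = dropEmpty-nonEmpty xss
  dropEmpty-nonEmpty ((x ∷ xs) ∷ xss) = (λ ()) ∷ dropEmpty-nonEmpty xss

  dropEmpty-All : ∀ {P : List V → Set} xss → All P xss → All P (dropEmpty xss)
  dropEmpty-All []               _        = []
  dropEmpty-All ([] ∷ xss)       (_ ∷ ps) = dropEmpty-All xss ps
  dropEmpty-All ((x ∷ xs) ∷ xss) (p ∷ ps) = p ∷ dropEmpty-All xss ps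

  concat-runs : ∀ w → concat (toList (runs w)) ≡ lefts w
  concat-runs []           = refl
  concat-runs (inj₁ x ∷ w) = cong (x ∷_) (concat-runs w)
  concat-runs (inj₂ _ ∷ w) = concat-runs w

  length-runs : ∀ w → length (toList (runs w)) ≡ suc (#rights w)
  length-runs []           = refl
  length-runs (inj₁ _ ∷ w) = length-runs w
  length-runs (inj₂ _ ∷ w) = cong suc (length-runs w)

  concat-pieces : ∀ w → concat (pieces w) ≡ lefts w
  concat-pieces w = trans (concat-dropEmpty (toList (runs w))) (concat-runs w)

  length-pieces : ∀ w → length (pieces w) ≤ suc (#rights w)
  length-pieces w = ≤-trans (length-dropEmpty (toList (runs w))) (≤-reflexive (length-runs w))

  module _ {R : V → V → Set} {S : V ⊎ B → V ⊎ B → Set} (S⇒R : ∀ {x y} → S (inj₁ x) (inj₁ y) → R x y) where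

    private
      Linked-extendRun : ∀ x w → Linked S (inj₁ x ∷ w) →
                         Linked R (List⁺.head (runs w)) → Linked R (x ∷ List⁺.head (runs w))
      Linked-extendRun x []           _       _ = [-]
      Linked-extendRun x (inj₁ _ ∷ w) (r ∷ _) l = S⇒R r ∷ l
      Linked-extendRun x (inj₂ _ ∷ w) _       _ = [-]

    Linked-runs : ∀ w → Linked S w → All (Linked R) (toList (runs w))
    Linked-runs []           _ = [] ∷ []
    Linked-runs (inj₁ x ∷ w) l with Linked-runs w (Linked.tail l)
    ... | lr ∷ lrs = Linked-extendRun x w l lr ∷ lrs
    Linked-runs (inj₂ _ ∷ w) l = [] ∷ Linked-runs w (Linked.tail l)

    Linked-pieces : ∀ w → Linked S w → All (λ q → (q ≢ []) × Linked R q) (pieces w)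
    Linked-pieces w l = All.zip (dropEmpty-nonEmpty (toList (runs w)) , dropEmpty-All (toList (runs w)) (Linked-runs w l))

  concat-deleteRights : ∀ ws → concat (deleteRights ws) ≡ lefts (concat ws)
  concat-deleteRights []       = refl
  concat-deleteRights (w ∷ ws) = begin
    concat (pieces w ++ deleteRights ws)           ≡⟨ sym (concat-++ (pieces w) (deleteRights ws)) ⟩
    concat (pieces w) ++ concat (deleteRights ws)  ≡⟨ cong₂ _++_ (concat-pieces w) (concat-deleteRights ws) ⟩
    lefts w ++ lefts (concat ws)                   ≡⟨ sym (lefts-++ w (concat ws)) ⟩
    lefts (w ++ concat ws)                         ∎
    where open ≡-Reasoning

  length-deleteRights : ∀ ws → length (deleteRights ws) ≤ length ws + #rights (concat ws)
  length-deleteRights []       = z≤n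
  length-deleteRights (w ∷ ws) = begin
    length (pieces w ++ deleteRights ws)                 ≡⟨ length-++ (pieces w) ⟩
    length (pieces w) + length (deleteRights ws)         ≤⟨ +-mono-≤ (length-pieces w) (length-deleteRights ws) ⟩
    suc (#rights w) + (length ws + #rights (concat ws))  ≡⟨ cong suc (x∙yz≈y∙xz (#rights w) (length ws) _) ⟩
    suc (length ws + (#rights w + #rights (concat ws)))  ≡⟨ cong (λ n → suc (length ws + n)) (sym (#rights-++ w (concat ws))) ⟩
    suc (length ws + #rights (w ++ concat ws))           ∎
    where open ≤-Reasoning

join≅JAdj' : ∀ l G → Adj (join l G) ≅ JAdj' l G
join≅JAdj' l G = record
  { to       = splitAt (order G)
  ; from     = joinFin (order G) l
  ; from∘to  = join-splitAt (order G) l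
  ; to∘from  = splitAt-join (order G) l
  ; to-hom   = λ r → r
  ; from-hom = λ {x} {y} r →
      subst₂ (JAdj' l G) (sym (splitAt-join (order G) l x)) (sym (splitAt-join (order G) l y)) r }

join0≅ : ∀ G → Adj (join 0 G) ≅ Adj G
join0≅ G = ≅-trans (join≅JAdj' 0 G) record
  { to = to′ ; from = inj₁ ; from∘to = from∘to′ ; to∘from = λ _ → refl
  ; to-hom = λ {x} {y} → to-hom′ x y ; from-hom = λ r → r }
  where
    to′ : Vertex G ⊎ Fin 0 → Vertex G
    to′ (inj₁ v) = v
    from∘to′ : ∀ x → inj₁ (to′ x) ≡ x
    from∘to′ (inj₁ v) = refl
    to-hom′ : ∀ x y → JAdj' 0 G x y → Adj G (to′ x) (to′ y)
    to-hom′ (inj₁ _) (inj₁ _) r = r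

-- The clique K_l of K_l ∗ (K_s ∗ G) becomes the first l vertices of K_{l+s}, and K_s the last s.
module JoinJoin (l s : ℕ) (G : Graph) where

  private
    n = order G

    inner : Vertex G ⊎ Fin s → Vertex G ⊎ Fin (l + s)
    inner (inj₁ v) = inj₁ v
    inner (inj₂ b) = inj₂ (l ↑ʳ b)

    outer : Fin l ⊎ Fin s → Vertex (join s G) ⊎ Fin l
    outer (inj₁ a) = inj₂ a
    outer (inj₂ b) = inj₁ (n ↑ʳ b)

    to′ : Vertex (join s G) ⊎ Fin l → Vertex G ⊎ Fin (l + s)
    to′ (inj₁ u) = inner (splitAt n u)
    to′ (inj₂ a) = inj₂ (a ↑ˡ s)

    from′ : Vertex G ⊎ Fin (l + s) → Vertex (join s G) ⊎ Fin l
    from′ (inj₁ v) = inj₁ (v ↑ˡ s)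
    from′ (inj₂ c) = outer (splitAt l c)

    ↑ˡ≢↑ʳ : ∀ (a : Fin l) (b : Fin s) → a ↑ˡ s ≢ l ↑ʳ b
    ↑ˡ≢↑ʳ a b eq with trans (sym (splitAt-↑ˡ l a s)) (trans (cong (splitAt l) eq) (splitAt-↑ʳ l s b))
    ... | ()

    from∘inner : ∀ p → from′ (inner p) ≡ inj₁ (joinFin n s p)
    from∘inner (inj₁ v) = refl
    from∘inner (inj₂ b) rewrite splitAt-↑ʳ l s b = refl

    to∘outer : ∀ p → to′ (outer p) ≡ inj₂ (joinFin l s p)
    to∘outer (inj₁ a) = refl
    to∘outer (inj₂ b) rewrite splitAt-↑ʳ n s b = refl

    from∘to′ : ∀ x → from′ (to′ x) ≡ x
    from∘to′ (inj₁ u) = trans (from∘inner (splitAt n u)) (cong inj₁ (join-splitAt n s u))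
    from∘to′ (inj₂ a) rewrite splitAt-↑ˡ l a s = refl

    to∘from′ : ∀ y → to′ (from′ y) ≡ y
    to∘from′ (inj₁ v) rewrite splitAt-↑ˡ n v s = refl
    to∘from′ (inj₂ c) = trans (to∘outer (splitAt l c)) (cong inj₂ (join-splitAt l s c))

    inner-hom : ∀ p q → JAdj' s G p q → JAdj' (l + s) G (inner p) (inner q)
    inner-hom (inj₁ _) (inj₁ _) r = r
    inner-hom (inj₁ _) (inj₂ _) _ = tt
    inner-hom (inj₂ _) (inj₁ _) _ = tt
    inner-hom (inj₂ b) (inj₂ b′) b≢b′ = b≢b′ ∘ ↑ʳ-injective l b b′

    inner-clique : ∀ p a → JAdj' (l + s) G (inner p) (inj₂ (a ↑ˡ s))
    inner-clique (inj₁ _) a = tt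
    inner-clique (inj₂ b) a = ↑ˡ≢↑ʳ a b ∘ sym

    to-hom′ : ∀ x y → JAdj' l (join s G) x y → JAdj' (l + s) G (to′ x) (to′ y)
    to-hom′ (inj₁ u) (inj₁ u′) r = inner-hom (splitAt n u) (splitAt n u′) r
    to-hom′ (inj₁ u) (inj₂ a)  _ = inner-clique (splitAt n u) a
    to-hom′ (inj₂ a) (inj₁ u)  _ =
      JAdj'-sym (l + s) G (inner (splitAt n u)) (inj₂ (a ↑ˡ s)) (inner-clique (splitAt n u) a)
    to-hom′ (inj₂ a) (inj₂ a′) a≢a′ = a≢a′ ∘ ↑ˡ-injective s a a′

    lifted-outer : ∀ v p → JAdj' l (join s G) (inj₁ (v ↑ˡ s)) (outer p)
    lifted-outer v (inj₁ _) = tt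
    lifted-outer v (inj₂ b) rewrite splitAt-↑ˡ n v s | splitAt-↑ʳ n s b = tt

    outer-hom : ∀ p q → joinFin l s p ≢ joinFin l s q → JAdj' l (join s G) (outer p) (outer q)
    outer-hom (inj₁ a) (inj₁ a′) ne = ne ∘ cong (_↑ˡ s)
    outer-hom (inj₁ _) (inj₂ _)  _  = tt
    outer-hom (inj₂ _) (inj₁ _)  _  = tt
    outer-hom (inj₂ b) (inj₂ b′) ne rewrite splitAt-↑ʳ n s b | splitAt-↑ʳ n s b′ = ne ∘ cong (l ↑ʳ_)

    from-hom′ : ∀ x y → JAdj' (l + s) G x y → JAdj' l (join s G) (from′ x) (from′ y)
    from-hom′ (inj₁ v) (inj₁ v′) r rewrite splitAt-↑ˡ n v s | splitAt-↑ˡ n v′ s = r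
    from-hom′ (inj₁ v) (inj₂ c)  _ = lifted-outer v (splitAt l c)
    from-hom′ (inj₂ c) (inj₁ v)  _ =
      JAdj'-sym l (join s G) (inj₁ (v ↑ˡ s)) (outer (splitAt l c)) (lifted-outer v (splitAt l c))
    from-hom′ (inj₂ c) (inj₂ c′) c≢c′ = outer-hom (splitAt l c) (splitAt l c′)
      (subst₂ _≢_ (sym (join-splitAt l s c)) (sym (join-splitAt l s c′)) c≢c′)

  JAdj'-join≅ : JAdj' l (join s G) ≅ JAdj' (l + s) G
  JAdj'-join≅ = record
    { to = to′ ; from = from′ ; from∘to = from∘to′ ; to∘from = to∘from′
    ; to-hom = λ {x} {y} → to-hom′ x y ; from-hom = λ {x} {y} → from-hom′ x y }

join-join≅ : ∀ l s G → Adj (join l (join s G)) ≅ Adj (join (l + s) G)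
join-join≅ l s G =
  ≅-trans (join≅JAdj' l (join s G)) (≅-trans (JoinJoin.JAdj'-join≅ l s G) (≅-sym (join≅JAdj' (l + s) G)))

Hamiltonian-join-join⁺ : Hamiltonian (join l (join s G)) → Hamiltonian (join (l + s) G)
Hamiltonian-join-join⁺ {l} {s} {G} = Hamiltonian-≅ {join l (join s G)} {join (l + s) G} (join-join≅ l s G)

Hamiltonian-join-join⁻ : Hamiltonian (join (l + s) G) → Hamiltonian (join l (join s G))
Hamiltonian-join-join⁻ {l} {s} {G} = Hamiltonian-≅ {join (l + s) G} {join l (join s G)} (≅-sym (join-join≅ l s G))

module Cone (H : Graph) where

  private
    W = Vertex H ⊎ Fin 1
    i = join≅JAdj' 1 H

  _~_ : W → W → Set
  _~_ = JAdj' 1 H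

  apex : W
  apex = inj₂ zero

  lift : List (Vertex H) → List W
  lift = map inj₁

  private
    apex∉lift : ∀ xs → apex ∉ lift xs
    apex∉lift xs m with ∈-map⁻ inj₁ m
    ... | _ , _ , ()

    Unique-apex∷lift : ∀ {xs} → Unique xs → Unique (apex ∷ lift xs)
    Unique-apex∷lift {xs} u = Allₚ.¬Any⇒All¬ _ (apex∉lift xs) ∷ Uniqueₚ.map⁺ inj₁-injective u

    ∈-apex∷lift : ∀ {xs} → (∀ v → v ∈ xs) → ∀ w → w ∈ apex ∷ lift xs
    ∈-apex∷lift c (inj₁ v)    = there (∈-map⁺ inj₁ (c v))
    ∈-apex∷lift c (inj₂ zero) = here refl

    Linked-lift : ∀ {p} → Linked (Adj H) p → Linked _~_ (lift p)
    Linked-lift = Linkedₚ.map⁺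

    Linked-lift-apex : ∀ p {ws} → Linked (Adj H) p → Linked _~_ (apex ∷ ws) → Linked _~_ (lift p ++ apex ∷ ws)
    Linked-lift-apex []           _       l = l
    Linked-lift-apex (_ ∷ [])     _       l = tt ∷ l
    Linked-lift-apex (_ ∷ y ∷ p) (r ∷ lp) l = r ∷ Linked-lift-apex (y ∷ p) lp l

    Linked-apex-lift : ∀ {q} → Linked (Adj H) q → Linked _~_ (apex ∷ lift q)
    Linked-apex-lift {[]}    _ = [-]
    Linked-apex-lift {_ ∷ _} l = tt ∷ Linked-lift l

    lift-apex-≢[] : ∀ p {ws} → lift p ++ apex ∷ ws ≢ []
    lift-apex-≢[] []      ()
    lift-apex-≢[] (_ ∷ _) ()

    lift-≢[] : ∀ {p} → p ≢ [] → lift p ≢ []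
    lift-≢[] {[]}    p≢[] = ⊥-elim (p≢[] refl)
    lift-≢[] {_ ∷ _} _    = λ ()

    -- Taking q = [] handles a one-path covering: concat (p ∷ [] ∷ []) reduces to concat [ p ].
    threadApex : ∀ p q rs → Path (Adj H) p → Linked (Adj H) q → All (Path (Adj H)) rs →
                 Unique (concat (p ∷ q ∷ rs)) → (∀ v → v ∈ concat (p ∷ q ∷ rs)) →
                 PathCover _~_ (suc (length rs))
    threadApex p q rs (_ , _ , lp) lq paths u c =
      subst (PathCover _~_) (cong suc (length-map lift rs))
        (pathCover ((lift p ++ apex ∷ lift q) ∷ map lift rs)
          ((lift-apex-≢[] p , Linked-lift-apex p lp (Linked-apex-lift lq))
             ∷ Allₚ.map⁺ (All.map (λ (ne , _ , l) → lift-≢[] ne , Linked-lift l) paths))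
          (Unique-resp-↭ (↭-sym threaded↭) (Unique-apex∷lift u))
          (λ w → ∈-resp-↭ (↭-sym threaded↭) (∈-apex∷lift c w)))
      where
        open PermutationReasoning
        threaded↭ : concat ((lift p ++ apex ∷ lift q) ∷ map lift rs) ↭ apex ∷ lift (concat (p ∷ q ∷ rs))
        threaded↭ = begin
          (lift p ++ apex ∷ lift q) ++ concat (map lift rs)  ≡⟨ ++-assoc (lift p) (apex ∷ lift q) _ ⟩
          lift p ++ apex ∷ lift q ++ concat (map lift rs)    ≡⟨ cong (λ zs → lift p ++ apex ∷ lift q ++ zs) (concat-map rs) ⟩
          lift p ++ apex ∷ lift q ++ lift (concat rs)        ≡⟨ cong (λ zs → lift p ++ apex ∷ zs) (sym (map-++ inj₁ q (concat rs))) ⟩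
          lift p ++ apex ∷ lift (q ++ concat rs)             ↭⟨ shift apex (lift p) _ ⟩
          apex ∷ lift p ++ lift (q ++ concat rs)             ≡⟨ cong (apex ∷_) (sym (map-++ inj₁ p (q ++ concat rs))) ⟩
          apex ∷ lift (p ++ q ++ concat rs)                  ∎

  cover-addApex : ∀ {m} → PathCover (Adj H) m → PathCover _~_ (1 ⊔ (m ∸ 1))
  cover-addApex ([] , refl , _ , _ , c) with c zero
  ... | ()
  cover-addApex ((p ∷ []) , refl , path ∷ [] , u , c) = threadApex p [] [] path [] [] u c
  cover-addApex ((p ∷ q ∷ rs) , refl , path ∷ (_ , _ , lq) ∷ paths , u , c) = threadApex p q rs path lq paths u c

  private
    #rights≡0 : ∀ (w : List W) → All (apex ≢_) w → #rights w ≡ 0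
    #rights≡0 []              _            = refl
    #rights≡0 (inj₁ _ ∷ w)    (_ ∷ ≢s)     = #rights≡0 w ≢s
    #rights≡0 (inj₂ zero ∷ w) (apex≢ ∷ _)  = ⊥-elim (apex≢ refl)

    #rights≤1 : ∀ (w : List W) → Unique w → #rights w ≤ 1
    #rights≤1 []              _           = z≤n
    #rights≤1 (inj₁ _ ∷ w)    (_ ∷ u)     = #rights≤1 w u
    #rights≤1 (inj₂ zero ∷ w) (apex∉ ∷ _) = s≤s (≤-reflexive (#rights≡0 w apex∉))

  cover-deleteApex : ∀ {t} → PathCover _~_ t → ∃[ r ] PathCover (Adj H) r × r ≤ suc t
  cover-deleteApex (ps , refl , paths , u , c) =
      length (deleteRights ps)
    , pathCover (deleteRights ps)
        (Allₚ.concat⁺ (Allₚ.map⁺ (All.map (λ (_ , _ , l) → Linked-pieces {R = Adj H} {S = _~_} (λ r → r) _ l)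
                                            paths)))
        (subst Unique (sym (concat-deleteRights ps)) (Unique-lefts (concat ps) u))
        (λ v → subst (v ∈_) (sym (concat-deleteRights ps)) (∈-lefts (concat ps) (c (inj₁ v))))
    , ≤-trans (length-deleteRights ps)
        (≤-trans (+-monoʳ-≤ (length ps) (#rights≤1 (concat ps) u)) (≤-reflexive (+-comm (length ps) 1)))

  SpanningPath⇒Hamiltonian-join₁ : SpanningPath (Adj H) → Hamiltonian (join 1 H)
  SpanningPath⇒Hamiltonian-join₁ ([] , (p≢[] , _) , _) = ⊥-elim (p≢[] refl)
  SpanningPath⇒Hamiltonian-join₁ ((x ∷ []) , _ , c) =
    inj₂ (inj₁ (cong (λ n → suc (n + 1)) (suc-injective (singleton-spanning⇒order≡1 x c))
               , from i (inj₁ x) , from i apex , from-hom i {inj₁ x} {apex} tt))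
  SpanningPath⇒Hamiltonian-join₁ (p@(x ∷ z ∷ zs) , (_ , u , l) , c) =
    inj₂ (inj₂ (HamCycle-map (≅-sym i)
      ( inj₁ x , lift (z ∷ zs) ++ [ apex ]
      , s≤s (subst (1 ≤_) (sym (length-++-sucʳ (lift zs) apex [])) (s≤s z≤n))
      , Unique-resp-↭ (++-comm [ apex ] (lift p)) (Unique-apex∷lift u)
      , (λ w → ∈-resp-↭ (++-comm [ apex ] (lift p)) (∈-apex∷lift c w))
      , subst (Linked _~_) (sym (++-assoc (lift p) [ apex ] [ inj₁ x ])) (Linked-lift-apex p l (tt ∷ [-])))))

IsMu-join₁ : IsMu H m → IsMu (join 1 H) (1 ⊔ (m ∸ 1))
IsMu-join₁ {H} {m} (cover , minimal) =
  PathCover-map (≅-sym (join≅JAdj' 1 H)) (Cone.cover-addApex H cover) , bound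
  where
    bound : ∀ t → PathCovering (join 1 H) t → 1 ⊔ (m ∸ 1) ≤ t
    bound t cover′ with Cone.cover-deleteApex H (PathCover-map (join≅JAdj' 1 H) cover′)
    ... | r , coverᴴ , r≤1+t =
      ⊔-lub (PathCovering-positive {join 1 H} cover′) (m≤n+o⇒m∸n≤o m 1 (≤-trans (minimal r coverᴴ) r≤1+t))

1⊔[1⊔n∸1]≡1⊔pred[n] : ∀ n → 1 ⊔ ((1 ⊔ n) ∸ 1) ≡ 1 ⊔ pred n
1⊔[1⊔n∸1]≡1⊔pred[n] zero    = refl
1⊔[1⊔n∸1]≡1⊔pred[n] (suc n) = refl

IsMu-join : IsMu G m → ∀ s → IsMu (join s G) (1 ⊔ (m ∸ s))
IsMu-join {G} {m} μ zero =
  subst (IsMu (join 0 G)) (sym (m≤n⇒m⊔n≡n (IsMu-positive {G} μ))) (IsMu-≅ {G} {join 0 G} (≅-sym (join0≅ G)) μ)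
IsMu-join {G} {m} μ (suc s) =
  subst (IsMu (join (suc s) G)) (trans (1⊔[1⊔n∸1]≡1⊔pred[n] (m ∸ s)) (cong (1 ⊔_) (pred[m∸n]≡m∸[1+n] m s)))
    (IsMu-≅ {join 1 (join s G)} {join (suc s) G} (join-join≅ 1 s G) (IsMu-join₁ (IsMu-join μ s)))

IsMu⇒Hamiltonian-join : IsMu G m → m ≤ suc s → Hamiltonian (join (suc s) G)
IsMu⇒Hamiltonian-join {G} {m} {s} μ m≤1+s =
  Hamiltonian-join-join⁺ (Cone.SpanningPath⇒Hamiltonian-join₁ (join s G)
    (PathCover₁⇒SpanningPath (subst (PathCovering (join s G)) μ≡1 (proj₁ (IsMu-join μ s)))))
  where
    μ≡1 : 1 ⊔ (m ∸ s) ≡ 1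
    μ≡1 = m≥n⇒m⊔n≡m (m≤n+o⇒m∸n≤o m s (subst (m ≤_) (+-comm 1 s) m≤1+s))

non-Hamiltonian-join⇒< : IsMu G m → ¬ Hamiltonian (join s G) → s < m
non-Hamiltonian-join⇒< {G} {s = zero}  μ _ = IsMu-positive {G} μ
non-Hamiltonian-join⇒< {m = m} {s = suc s} μ ¬h with m ≤? suc s
... | yes m≤1+s = contradiction (IsMu⇒Hamiltonian-join μ m≤1+s) ¬h
... | no  m≰1+s = ≰⇒> m≰1+s

Hamiltonian-join-step : Hamiltonian (join l G) → Hamiltonian (join (suc l) G)
Hamiltonian-join-step {l} {G} h =
  Hamiltonian-join-join⁺ (Cone.SpanningPath⇒Hamiltonian-join₁ (join l G) (Hamiltonian⇒SpanningPath {join l G} h))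

Hamiltonian-join-mono : l ≤ l′ → Hamiltonian (join l G) → Hamiltonian (join l′ G)
Hamiltonian-join-mono {l} {G = G} l≤l′ h = go (≤⇒≤′ l≤l′)
  where
    go : ∀ {l′} → l ≤′ l′ → Hamiltonian (join l′ G)
    go ≤′-refl       = h
    go (≤′-step l≤′) = Hamiltonian-join-step {G = G} (go l≤′)

IsMuCheck-join : IsMuCheck G c → ∀ s → IsMuCheck (join s G) (c ∸ s)
IsMuCheck-join {G} {c} (h , minimal) s =
    Hamiltonian-join-join⁻ (Hamiltonian-join-mono {G = G} c≤c∸s+s h)
  , λ l hₗ → m≤n+o⇒m∸n≤o c s (subst (c ≤_) (+-comm l s) (minimal (l + s) (Hamiltonian-join-join⁺ hₗ)))
  where
    c≤c∸s+s : c ≤ c ∸ s + s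
    c≤c∸s+s = subst (c ≤_) (+-comm s (c ∸ s)) (m≤n+m∸n c s)

lemma2p5 : (G : Graph) (s m c : ℕ) → IsMu G m → IsMuCheck G c →
    IsMu (join s G) (1 ⊔ (m ∸ s)) × IsMuCheck (join s G) (c ∸ s)
    × (Hamiltonian (join s G) → IsMu (join s G) 1 × IsMuCheck (join s G) 0)
    × (¬ Hamiltonian (join s G) → IsMu (join s G) (m ∸ s) × IsMuCheck (join s G) (c ∸ s))
lemma2p5 G s m c μG μ̌G =
    μJ , μ̌J
  , (λ h → subst (IsMu J) (IsMu-Hamiltonian {J} μJ h) μJ
         , subst (IsMuCheck J) (m≤n⇒m∸n≡0 (proj₂ μ̌G s h)) μ̌J)
  , (λ ¬h → subst (IsMu J) (m≤n⇒m⊔n≡n (m<n⇒0<n∸m (non-Hamiltonian-join⇒< {G} μG ¬h))) μJ , μ̌J)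
  where
    J = join s G
    μJ = IsMu-join μG s
    μ̌J = IsMuCheck-join μ̌G s
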